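{- Let $n$ be a positive integer, let $D=\{a_1,\ldots,a_m\}$ be a $B_2$-sequence over $\mathbb{Z}_n$, and let $n=\ell k$ with $\ell,k$ positive integers and $\gcd(\ell,k)=1$. Define the array $\mathcal{A}$ on $\mathbb{Z}^2$ by placing a dot at $(i,j)$ if and only if $a_t\equiv i\ell+jk\pmod n$ for some $t$. Then $\mathcal{A}$ is a doubly periodic $\ell\times k$ DDC of period $(k,\ell)$ and density $m/n$. Moreover, every $\ell\times k$ sub-array of $\mathcal{A}$ contains exactly $m$ dots.
   Context: For an abelian group $A$, a sequence $D=\{a_1,\ldots,a_m\}$ of $m$ distinct elements of $A$ is a $B_2$-sequence over $A$ if all sums $a_{i_1}+a_{i_2}$ with $1\le i_1\le i_2\le m$ are distinct. Points $(i,j)\in\mathbb{Z}^2$ are in column $i$ and row $j$. An array of dots $\mathcal{A}$ on $\mathbb{Z}^2$ is doubly periodic with period $(\eta,\kappa)$ if $(i,j)$ is a dot iff $(i+\eta,j)$ is a dot iff $(i,j+\kappa)$ is a dot, for all $i,j$; its density is $d/(\eta\kappa)$ where $d$ is the number of dots in any $\kappa\times\eta$ sub-array. An $a\times b$ sub-array is a set $\{(i_0+i,j_0+j):0\le i\le b-1,\ 0\le j\le a-1\}$ ($a$ rows, $b$ columns). A set of dots is a DDC if the vectors $x-y$, over ordered pairs $(x,y)$ of distinct dots, are pairwise distinct. A doubly periodic array is a doubly periodic $a\times b$ DDC if the dots in every $a\times b$ sub-array form a DDC. -}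

module Defs where

open import Data.Nat as ℕ using (ℕ; NonZero; _%_)
open import Data.Integer as ℤ using (ℤ; +_)
open import Data.Integer.DivMod using (_%ℕ_)
open import Data.Fin as Fin using (Fin; toℕ)
open import Data.Fin.Properties using (any?)
open import Data.Product using (Σ; ∃; ∃-syntax; _×_; _,_; proj₁; proj₂)
open import Data.List using (List; upTo; map)
open import Data.Nat.ListAction using (sum)
open import Data.Bool using (if_then_else_)
open import Relation.Nullary using (Dec; does; ¬_)
open import Relation.Binary.PropositionalEquality using (_≡_; _≢_)
open import Function using (Injective)

-- ℤ_n, represented by residues Fin n; addition in ℤ_n (as a residue in ℕ).

addMod : (n : ℕ) .{{_ : NonZero n}} → Fin n → Fin n → ℕ
addMod n x y = (toℕ x ℕ.+ toℕ y) % n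

IsB₂ : (n : ℕ) .{{_ : NonZero n}} (m : ℕ) → (Fin m → Fin n) → Set
IsB₂ n m D =
  Injective _≡_ _≡_ D ×
  (∀ (i₁ i₂ j₁ j₂ : Fin m) → i₁ Fin.≤ i₂ → j₁ Fin.≤ j₂ →
     addMod n (D i₁) (D i₂) ≡ addMod n (D j₁) (D j₂) →
     (i₁ ≡ j₁ × i₂ ≡ j₂))

-- Arrays of dots on ℤ²: a predicate on (column i, row j).

Point : Set
Point = ℤ × ℤ

Array : Set₁
Array = ℤ → ℤ → Set

DecArray : Array → Set
DecArray A = ∀ i j → Dec (A i j)

DoublyPeriodic : Array → ℕ → ℕ → Set
DoublyPeriodic A η κ =
  ∀ (i j : ℤ) → (A i j → A (i ℤ.+ + η) j) × (A (i ℤ.+ + η) j → A i j)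
              × (A i j → A i (j ℤ.+ + κ)) × (A i (j ℤ.+ + κ) → A i j)

-- the a × b sub-array (a rows, b columns) with corner (i₀ , j₀)
InSub : ℕ → ℕ → ℤ → ℤ → Point → Set
InSub a b i₀ j₀ (i , j) =
  (i₀ ℤ.≤ i × i ℤ.< i₀ ℤ.+ + b) × (j₀ ℤ.≤ j × j ℤ.< j₀ ℤ.+ + a)

_-ᵖ_ : Point → Point → Point
(i , j) -ᵖ (i' , j') = (i ℤ.- i' , j ℤ.- j')

IsDDC : (Point → Set) → Set
IsDDC S = ∀ x y x' y' → S x → S y → S x' → S y' → x ≢ y → x' ≢ y' →
          x -ᵖ y ≡ x' -ᵖ y' → (x ≡ x' × y ≡ y')

DotsIn : Array → ℕ → ℕ → ℤ → ℤ → Point → Set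
DotsIn A a b i₀ j₀ p = InSub a b i₀ j₀ p × A (proj₁ p) (proj₂ p)

DoublyPeriodicDDC : Array → ℕ → ℕ → ℕ → ℕ → Set
DoublyPeriodicDDC A η κ a b =
  DoublyPeriodic A η κ × (∀ i₀ j₀ → IsDDC (DotsIn A a b i₀ j₀))

dotCount : (A : Array) → DecArray A → ℕ → ℕ → ℤ → ℤ → ℕ
dotCount A A? a b i₀ j₀ =
  sum (map (λ i → sum (map (λ j →
         if does (A? (i₀ ℤ.+ + i) (j₀ ℤ.+ + j)) then 1 else 0)
       (upTo a))) (upTo b))

-- density p/q for a doubly periodic array of period (η , κ): the number d of
-- dots in every κ × η sub-array satisfies d/(ηκ) = p/q (cross-multiplied)
HasDensity : (A : Array) → DecArray A → ℕ → ℕ → ℕ → ℕ → Set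
HasDensity A A? η κ p q =
  ∀ i₀ j₀ → dotCount A A? κ η i₀ j₀ ℕ.* q ≡ p ℕ.* (η ℕ.* κ)

Dot : (n : ℕ) .{{_ : NonZero n}} (m : ℕ) → (Fin m → Fin n) → ℕ → ℕ → Array
Dot n m D ℓ k i j = ∃[ t ] toℕ (D t) ≡ (i ℤ.* + ℓ ℤ.+ j ℤ.* + k) %ℕ n

Dot? : (n : ℕ) .{{_ : NonZero n}} (m : ℕ) (D : Fin m → Fin n) (ℓ k : ℕ) →
       DecArray (Dot n m D ℓ k)
Dot? n m D ℓ k i j = any? (λ t → toℕ (D t) ℕ.≟ (i ℤ.* + ℓ ℤ.+ j ℤ.* + k) %ℕ n)

module Submission where

-- The dot at (i , j) records whether iℓ + jk mod n is one of the aₜ.  Since kℓ = n this residue is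
-- unchanged by (i , j) ↦ (i + k , j) and (i , j) ↦ (i , j + ℓ), and since ℓ and k are coprime the
-- Chinese remainder theorem makes it a bijection from every ℓ × k sub-array onto ℤₙ.  Hence every
-- such sub-array contains exactly m dots, which also gives the density m/n.  For the DDC property,
-- if dots x, y, x′, y′ of one sub-array labelled s, t, s′, t′ satisfy x − y = x′ − y′, then
-- aₛ + aₜ′ = aₛ′ + aₜ in ℤₙ, so the B₂ property gives {s , t′} = {s′ , t}; s = t is impossible as
-- x ≠ y, and s = s′, t = t′ give x = x′, y = y′ by the bijectivity on the sub-array.

open import Defs
open import Data.Nat as ℕ using (ℕ; NonZero)
import Data.Nat.Properties as ℕ
import Data.Nat.DivMod as ℕ
import Data.Nat.Divisibility as ℕ
open import Data.Nat.Coprimality using (Coprime; coprime-Bézout)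
open import Data.Nat.GCD using (module Bézout)
import Data.Nat.ListAction as List
open import Data.Integer as ℤ using (+_)
open import Data.Fin using (Fin; toℕ; punchIn; fromℕ<)
open import Data.Fin.Properties as Fin using (any?; punchInᵢ≢i; toℕ-injective; toℕ-fromℕ<; toℕ<n)
open import Data.Product using (_×_; _,_; ∃₂; ∃-syntax; proj₁; proj₂; swap)
open import Data.Sum using (_⊎_; inj₁; inj₂; [_,_]′)
open import Data.Bool using (if_then_else_)
open import Data.Empty using (⊥-elim)
open import Data.List using (map; applyUpTo; upTo)
open import Function using (_∘_; flip; Injective)
open import Relation.Nullary using (Dec; does; yes; no; ¬_)
open import Relation.Nullary.Decidable using (dec-true; dec-false)
open import Relation.Unary using (Decidable)
open import Relation.Binary.PropositionalEquality
  using (_≡_; _≢_; refl; sym; trans; cong; cong₂; subst; subst₂; module ≡-Reasoning)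
open import Algebra.Properties.CommutativeMonoid.Sum ℕ.+-0-commutativeMonoid
  using (sum; sum-syntax; ∑-comm; sum-remove; sum-cong-≗; sum-replicate-zero)

open ≡-Reasoning

-- Counting with indicators

𝟙 : ∀ {p} {P : Set p} → Dec P → ℕ
𝟙 P? = if does P? then 1 else 0

𝟙-yes : ∀ {p} {P : Set p} (P? : Dec P) → P → 𝟙 P? ≡ 1
𝟙-yes P? p = cong (if_then 1 else 0) (dec-true P? p)

𝟙-no : ∀ {p} {P : Set p} (P? : Dec P) → ¬ P → 𝟙 P? ≡ 0
𝟙-no P? ¬p = cong (if_then 1 else 0) (dec-false P? ¬p)

∑-1 : ∀ m → ∑[ i < m ] 1 ≡ m
∑-1 ℕ.zero    = refl
∑-1 (ℕ.suc m) = cong ℕ.suc (∑-1 m)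

∑-vanishing : ∀ {m} (f : Fin m → ℕ) → (∀ i → f i ≡ 0) → ∑[ i < m ] f i ≡ 0
∑-vanishing {m} f f≡0 = trans (sum-cong-≗ f≡0) (sum-replicate-zero m)

∑-concentrated : ∀ {m} (f : Fin m → ℕ) i → (∀ j → j ≢ i → f j ≡ 0) → ∑[ j < m ] f j ≡ f i
∑-concentrated {ℕ.suc m} f i f≡0 = begin
  sum f                               ≡⟨ sum-remove {i = i} f ⟩
  f i ℕ.+ ∑[ j < m ] f (punchIn i j)  ≡⟨ cong (f i ℕ.+_) (∑-vanishing _ (λ j → f≡0 _ (punchInᵢ≢i i j))) ⟩
  f i ℕ.+ 0                           ≡⟨ ℕ.+-identityʳ (f i) ⟩
  f i                                 ∎

𝟙-any : ∀ {m p} {P : Fin m → Set p} (P? : Decidable P) → (∀ {i j} → P i → P j → i ≡ j) →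
        𝟙 (any? P?) ≡ ∑[ i < m ] 𝟙 (P? i)
𝟙-any P? unique with any? P?
... | yes (i , Pi) = sym (trans (∑-concentrated _ i (λ j j≢i → 𝟙-no (P? j) (j≢i ∘ flip unique Pi)))
                                (𝟙-yes (P? i) Pi))
... | no ¬∃P      = sym (∑-vanishing _ (λ i → 𝟙-no (P? i) (¬∃P ∘ (i ,_))))

∑∑-𝟙-unique : ∀ {a b p} {P : Fin a → Fin b → Set p} (P? : ∀ x y → Dec (P x y)) {x₀ y₀} →
              P x₀ y₀ → (∀ {x y} → P x y → x ≡ x₀ × y ≡ y₀) →
              ∑[ x < a ] ∑[ y < b ] 𝟙 (P? x y) ≡ 1
∑∑-𝟙-unique P? {x₀} {y₀} Px₀y₀ unique = begin
  ∑[ x < _ ] ∑[ y < _ ] 𝟙 (P? x y)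
    ≡⟨ ∑-concentrated _ x₀ (λ x x≢x₀ → ∑-vanishing _ (λ y → 𝟙-no (P? x y) (x≢x₀ ∘ proj₁ ∘ unique))) ⟩
  ∑[ y < _ ] 𝟙 (P? x₀ y)
    ≡⟨ ∑-concentrated _ y₀ (λ y y≢y₀ → 𝟙-no (P? x₀ y) (y≢y₀ ∘ proj₂ ∘ unique)) ⟩
  𝟙 (P? x₀ y₀)
    ≡⟨ 𝟙-yes (P? x₀ y₀) Px₀y₀ ⟩
  1 ∎

∑∑-𝟙-∈-image : ∀ {m a b} (g : Fin m → ℕ) → Injective _≡_ _≡_ g →
  (f : Fin a → Fin b → ℕ) → (∀ {x y x' y'} → f x y ≡ f x' y' → x ≡ x' × y ≡ y') →
  (∀ t → ∃₂ λ x y → f x y ≡ g t) →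
  ∑[ x < a ] ∑[ y < b ] 𝟙 (any? (λ t → g t ℕ.≟ f x y)) ≡ m
∑∑-𝟙-∈-image {m} {a} {b} g g-injective f f-injective f-hits = begin
  ∑[ x < a ] ∑[ y < b ] 𝟙 (any? (λ t → g t ℕ.≟ f x y))
    ≡⟨ sum-cong-≗ (λ x → sum-cong-≗ (λ y →
         𝟙-any (λ t → g t ℕ.≟ f x y) (λ gs≡fxy gt≡fxy → g-injective (trans gs≡fxy (sym gt≡fxy))))) ⟩
  ∑[ x < a ] ∑[ y < b ] ∑[ t < m ] 𝟙 (g t ℕ.≟ f x y)
    ≡⟨ sum-cong-≗ (λ x → ∑-comm (λ y t → 𝟙 (g t ℕ.≟ f x y))) ⟩
  ∑[ x < a ] ∑[ t < m ] ∑[ y < b ] 𝟙 (g t ℕ.≟ f x y)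
    ≡⟨ ∑-comm (λ x t → ∑[ y < b ] 𝟙 (g t ℕ.≟ f x y)) ⟩
  ∑[ t < m ] ∑[ x < a ] ∑[ y < b ] 𝟙 (g t ℕ.≟ f x y)
    ≡⟨ sum-cong-≗ hit-once ⟩
  ∑[ t < m ] 1
    ≡⟨ ∑-1 m ⟩
  m ∎
  where
  hit-once : ∀ t → ∑[ x < a ] ∑[ y < b ] 𝟙 (g t ℕ.≟ f x y) ≡ 1
  hit-once t =
    let x₀ , y₀ , fx₀y₀≡gt = f-hits t
    in ∑∑-𝟙-unique (λ x y → g t ℕ.≟ f x y) (sym fx₀y₀≡gt)
                   (λ gt≡fxy → f-injective (trans (sym gt≡fxy) (sym fx₀y₀≡gt)))

sum-map-applyUpTo : ∀ n (f g : ℕ → ℕ) → List.sum (map f (applyUpTo g n)) ≡ ∑[ i < n ] f (g (toℕ i))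
sum-map-applyUpTo ℕ.zero    f g = refl
sum-map-applyUpTo (ℕ.suc n) f g = cong (f (g 0) ℕ.+_) (sum-map-applyUpTo n f (g ∘ ℕ.suc))

sum-map-upTo : ∀ n (f : ℕ → ℕ) → List.sum (map f (upTo n)) ≡ ∑[ i < n ] f (toℕ i)
sum-map-upTo n f = sum-map-applyUpTo n f (λ i → i)

dotCount≡∑∑ : ∀ A (A? : DecArray A) a b i₀ j₀ →
  dotCount A A? a b i₀ j₀ ≡ ∑[ x < b ] ∑[ y < a ] 𝟙 (A? (i₀ ℤ.+ + toℕ x) (j₀ ℤ.+ + toℕ y))
dotCount≡∑∑ A A? a b i₀ j₀ = begin
  dotCount A A? a b i₀ j₀                     ≡⟨ sum-map-upTo b column ⟩
  ∑[ x < b ] column (toℕ x)                   ≡⟨ sum-cong-≗ {b} (λ x → sum-map-upTo a (cell (toℕ x))) ⟩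
  ∑[ x < b ] ∑[ y < a ] cell (toℕ x) (toℕ y)  ∎
  where
  cell : ℕ → ℕ → ℕ
  cell i j = 𝟙 (A? (i₀ ℤ.+ + i) (j₀ ℤ.+ + j))
  column : ℕ → ℕ
  column i = List.sum (map (cell i) (upTo a))

-- Congruences of integers and the Chinese remainder theorem

module Congruence where
  open import Data.Integer using (ℤ; +_; _+_; _-_; _*_; -_; _⊖_; ∣_∣; _%ℕ_; _/ℕ_; _≤_; _<_)
  open import Data.Integer.Properties
    using (+-injective; *-identityʳ; *-comm; i-j≡0⇒i≡j; 0≤i⇒+∣i∣≡i; i≤j⇒0≤j-i; +-monoˡ-<; drop‿+<+;
           [+m]-[+n]≡m⊖n; ∣i∣≡0⇒i≡0; ∣m⊝n∣≤m⊔n; pos-+; pos-*)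
  open import Data.Integer.DivMod using (a≡a%ℕn+[a/ℕn]*n; n%ℕd<d)
  open import Data.Integer.Divisibility.Signed
    using (_∣_; divides; ∣⇒∣ᵤ; ∣ᵤ⇒∣; ∣-refl; ∣-trans; ∣m∣n⇒∣m+n; ∣m⇒∣-m; ∣m+n∣m⇒∣n; ∣m+n∣n⇒∣m;
           ∣n⇒∣m*n; *-monoʳ-∣; *-cancelʳ-∣)
  open import Data.Integer.Coprimality using (coprime-divisor)
  open import Data.Integer.Tactic.RingSolver using (solve-∀)

  -- A record rather than an abbreviation of + d ∣ x - y, so that x and y can be inferred.
  infix 4 _≡_mod_
  record _≡_mod_ (x y : ℤ) (d : ℕ) : Set where
    constructor congruent
    field divides-difference : + d ∣ x - y

  ≡-mod-reflexive : ∀ {x y d} → x ≡ y → x ≡ y mod d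
  ≡-mod-reflexive {x} {d = d} refl = congruent (divides (+ 0) (vanish x (+ d)))
    where
    vanish : ∀ x d → x - x ≡ + 0 * d
    vanish = solve-∀

  ≡-mod-sym : ∀ {x y d} → x ≡ y mod d → y ≡ x mod d
  ≡-mod-sym {x} {y} (congruent d∣x-y) = congruent (subst (_ ∣_) (negate x y) (∣m⇒∣-m d∣x-y))
    where
    negate : ∀ x y → - (x - y) ≡ y - x
    negate = solve-∀

  ≡-mod-trans : ∀ {x y z d} → x ≡ y mod d → y ≡ z mod d → x ≡ z mod d
  ≡-mod-trans {x} {y} {z} (congruent d∣x-y) (congruent d∣y-z) =
    congruent (subst (_ ∣_) (telescope x y z) (∣m∣n⇒∣m+n d∣x-y d∣y-z))
    where
    telescope : ∀ x y z → (x - y) + (y - z) ≡ x - z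
    telescope = solve-∀

  ≡-mod-+ : ∀ {x x' y y' d} → x ≡ x' mod d → y ≡ y' mod d → x + y ≡ x' + y' mod d
  ≡-mod-+ {x} {x'} {y} {y'} (congruent d∣x-x') (congruent d∣y-y') =
    congruent (subst (_ ∣_) (regroup x x' y y') (∣m∣n⇒∣m+n d∣x-x' d∣y-y'))
    where
    regroup : ∀ x x' y y' → (x - x') + (y - y') ≡ (x + y) - (x' + y')
    regroup = solve-∀

  ≡-mod-+-cancelˡ : ∀ x {y y' d} → x + y ≡ x + y' mod d → y ≡ y' mod d
  ≡-mod-+-cancelˡ x {y} {y'} (congruent d∣difference) =
    congruent (subst (_ ∣_) (cancel x y y') d∣difference)
    where
    cancel : ∀ x y y' → x + y - (x + y') ≡ y - y'
    cancel = solve-∀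

  ≡-mod-*ʳ : ∀ {x y d} e → x ≡ y mod d → x * + e ≡ y * + e mod e ℕ.* d
  ≡-mod-*ʳ {x} {y} {d} e (congruent d∣x-y) =
    congruent (subst₂ _∣_ (sym (pos-* e d)) (distrib x y (+ e)) (*-monoʳ-∣ (+ e) d∣x-y))
    where
    distrib : ∀ x y e → e * (x - y) ≡ x * e - y * e
    distrib = solve-∀

  ≡-mod⇒≡ : ∀ {a b d} .{{_ : NonZero d}} → a ℕ.< d → b ℕ.< d → + a ≡ + b mod d → a ≡ b
  ≡-mod⇒≡ {a} {b} {d} a<d b<d (congruent d∣a-b) =
    +-injective (i-j≡0⇒i≡j (+ a) (+ b) (trans ([+m]-[+n]≡m⊖n a b) (∣i∣≡0⇒i≡0 ∣a⊖b∣≡0)))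
    where
    ∣a⊖b∣<d : ∣ a ⊖ b ∣ ℕ.< d
    ∣a⊖b∣<d = ℕ.≤-<-trans (∣m⊝n∣≤m⊔n a b) (ℕ.⊔-pres-<m a<d b<d)
    d∣∣a⊖b∣ : d ℕ.∣ ∣ a ⊖ b ∣
    d∣∣a⊖b∣ = subst (λ z → d ℕ.∣ ∣ z ∣) ([+m]-[+n]≡m⊖n a b) (∣⇒∣ᵤ d∣a-b)
    ∣a⊖b∣≡0 : ∣ a ⊖ b ∣ ≡ 0
    ∣a⊖b∣≡0 = trans (sym (ℕ.m<n⇒m%n≡m ∣a⊖b∣<d)) (ℕ.n∣m⇒m%n≡0 _ d d∣∣a⊖b∣)

  ≡-mod-%ℕ : ∀ x d .{{_ : NonZero d}} → x ≡ + (x %ℕ d) mod d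
  ≡-mod-%ℕ x d = congruent (divides (x /ℕ d) (begin
    x - + (x %ℕ d)                          ≡⟨ cong (_- + (x %ℕ d)) (a≡a%ℕn+[a/ℕn]*n x d) ⟩
    + (x %ℕ d) + x /ℕ d * + d - + (x %ℕ d)  ≡⟨ cancel (+ (x %ℕ d)) (x /ℕ d * + d) ⟩
    x /ℕ d * + d                            ∎))
    where
    cancel : ∀ r s → r + s - r ≡ s
    cancel = solve-∀

  ≡-mod⇒%ℕ≡ : ∀ {x y} d .{{_ : NonZero d}} → x ≡ y mod d → x %ℕ d ≡ y %ℕ d
  ≡-mod⇒%ℕ≡ {x} {y} d x≡y = ≡-mod⇒≡ (n%ℕd<d x d) (n%ℕd<d y d)
    (≡-mod-trans (≡-mod-sym (≡-mod-%ℕ x d)) (≡-mod-trans x≡y (≡-mod-%ℕ y d)))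

  %ℕ≡⇒≡-mod : ∀ {x y} d .{{_ : NonZero d}} → x %ℕ d ≡ y %ℕ d → x ≡ y mod d
  %ℕ≡⇒≡-mod {x} {y} d x%d≡y%d = ≡-mod-trans (≡-mod-%ℕ x d)
    (subst (λ r → + r ≡ y mod d) (sym x%d≡y%d) (≡-mod-sym (≡-mod-%ℕ y d)))

  %ℕ-distrib-+ : ∀ x y d .{{_ : NonZero d}} → (x + y) %ℕ d ≡ (x %ℕ d ℕ.+ y %ℕ d) ℕ.% d
  %ℕ-distrib-+ x y d = ≡-mod⇒%ℕ≡ d (subst (x + y ≡_mod d) (sym (pos-+ (x %ℕ d) (y %ℕ d)))
    (≡-mod-+ (≡-mod-%ℕ x d) (≡-mod-%ℕ y d)))

  [i+d]%ℕd≡i%ℕd : ∀ x d .{{_ : NonZero d}} → (x + + d) %ℕ d ≡ x %ℕ d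
  [i+d]%ℕd≡i%ℕd x d = ≡-mod⇒%ℕ≡ d (congruent {x + + d} {x} (divides (+ 1) (shift x (+ d))))
    where
    shift : ∀ x d → x + d - x ≡ + 1 * d
    shift = solve-∀

  ∃-offset-≡-mod : ∀ x₀ r d .{{_ : NonZero d}} → ∃[ a ] a ℕ.< d × x₀ + + a ≡ r mod d
  ∃-offset-≡-mod x₀ r d = (r - x₀) %ℕ d , n%ℕd<d (r - x₀) d ,
    ≡-mod-trans (≡-mod-+ (≡-mod-reflexive {x₀} refl) (≡-mod-sym (≡-mod-%ℕ (r - x₀) d)))
                (≡-mod-reflexive (restore x₀ r))
    where
    restore : ∀ x₀ r → x₀ + (r - x₀) ≡ r
    restore = solve-∀

  window-offset : ∀ {i₀ i d} → i₀ ≤ i → i < i₀ + + d → ∃[ a ] a ℕ.< d × i ≡ i₀ + + a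
  window-offset {i₀} {i} {d} i₀≤i i<i₀+d = ∣ i - i₀ ∣ , drop‿+<+ a<d , sym (begin
    i₀ + + ∣ i - i₀ ∣  ≡⟨ cong (_+_ i₀) a≡i-i₀ ⟩
    i₀ + (i - i₀)      ≡⟨ restore i₀ i ⟩
    i                  ∎)
    where
    restore : ∀ i₀ i → i₀ + (i - i₀) ≡ i
    restore = solve-∀
    shift : ∀ i₀ d → i₀ + d - i₀ ≡ d
    shift = solve-∀
    a≡i-i₀ : + ∣ i - i₀ ∣ ≡ i - i₀
    a≡i-i₀ = 0≤i⇒+∣i∣≡i (i≤j⇒0≤j-i i₀≤i)
    a<d : + ∣ i - i₀ ∣ < + d
    a<d = subst₂ _<_ (sym a≡i-i₀) (shift i₀ (+ d)) (+-monoˡ-< (- i₀) i<i₀+d)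

  window-≡-mod⇒≡ : ∀ {i₀ i i' d} .{{_ : NonZero d}} →
    i₀ ≤ i → i < i₀ + + d → i₀ ≤ i' → i' < i₀ + + d → i ≡ i' mod d → i ≡ i'
  window-≡-mod⇒≡ {i₀} {d = d} i₀≤i i<i₀+d i₀≤i' i'<i₀+d i≡i' =
    let a , a<d , i≡i₀+a = window-offset i₀≤i i<i₀+d
        a' , a'<d , i'≡i₀+a' = window-offset i₀≤i' i'<i₀+d
        a≡a' = ≡-mod⇒≡ a<d a'<d
                 (≡-mod-+-cancelˡ i₀ (subst₂ (λ x y → x ≡ y mod d) i≡i₀+a i'≡i₀+a' i≡i'))
    in trans i≡i₀+a (trans (cong (λ c → i₀ + + c) a≡a') (sym i'≡i₀+a'))

  -≡-⇒+≡+ : ∀ a b c d → a - b ≡ c - d → a + d ≡ c + b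
  -≡-⇒+≡+ a b c d a-b≡c-d = begin
    a + d            ≡⟨ expand a b d ⟩
    (a - b) + b + d  ≡⟨ cong (λ z → z + b + d) a-b≡c-d ⟩
    (c - d) + b + d  ≡⟨ collapse c d b ⟩
    c + b            ∎
    where
    expand : ∀ a b d → a + d ≡ (a - b) + b + d
    expand = solve-∀
    collapse : ∀ c d b → (c - d) + b + d ≡ c + b
    collapse = solve-∀

  pos-+-*-≡ : ∀ a b c d e → a ℕ.+ b ℕ.* c ≡ d ℕ.* e → + a + + b * + c ≡ + d * + e
  pos-+-*-≡ a b c d e eq = begin
    + a + + b * + c    ≡⟨ cong (_+_ (+ a)) (pos-* b c) ⟨
    + a + + (b ℕ.* c)  ≡⟨ pos-+ a (b ℕ.* c) ⟨
    + (a ℕ.+ b ℕ.* c)  ≡⟨ cong +_ eq ⟩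
    + (d ℕ.* e)        ≡⟨ pos-* d e ⟩
    + d * + e          ∎

  bézout : ∀ {ℓ k} → Coprime ℓ k → ∃₂ λ u v → u * + ℓ + v * + k ≡ + 1
  bézout {ℓ} {k} ℓ⊥k with coprime-Bézout ℓ⊥k
  ... | Bézout.+- x y 1+yk≡xℓ = + x , - + y , (begin
    + x * + ℓ + - + y * + k        ≡⟨ cong (_+ - + y * + k) (pos-+-*-≡ 1 y k x ℓ 1+yk≡xℓ) ⟨
    + 1 + + y * + k + - + y * + k  ≡⟨ cancel (+ 1) (+ y) (+ k) ⟩
    + 1                            ∎)
    where
    cancel : ∀ a y k → a + y * k + - y * k ≡ a
    cancel = solve-∀
  ... | Bézout.-+ x y 1+xℓ≡yk = - + x , + y , (begin
    - + x * + ℓ + + y * + k          ≡⟨ cong (_+_ (- + x * + ℓ)) (pos-+-*-≡ 1 x ℓ y k 1+xℓ≡yk) ⟨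
    - + x * + ℓ + (+ 1 + + x * + ℓ)  ≡⟨ cancel (+ 1) (+ x) (+ ℓ) ⟩
    + 1                              ∎)
    where
    cancel : ∀ a x ℓ → - x * ℓ + (a + x * ℓ) ≡ a
    cancel = solve-∀

  -- ℓ divides (y − y′)k, hence y − y′ by coprimality; then kℓ divides (x − x′)ℓ.
  crt-injective : ∀ {ℓ k} .{{_ : NonZero ℓ}} → Coprime ℓ k → ∀ {x y x' y'} →
    x * + ℓ + y * + k ≡ x' * + ℓ + y' * + k mod ℓ ℕ.* k → x ≡ x' mod k × y ≡ y' mod ℓ
  crt-injective {ℓ} {k} ℓ⊥k {x} {y} {x'} {y'} (congruent ℓk∣difference) =
    congruent (*-cancelʳ-∣ (+ ℓ) kℓ∣Δxℓ) , congruent ℓ∣Δy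
    where
    Δx = x - x'
    Δy = y - y'
    split : ∀ x y x' y' ℓ k → x * ℓ + y * k - (x' * ℓ + y' * k) ≡ (x - x') * ℓ + k * (y - y')
    split = solve-∀
    kℓ∣sum : + k * + ℓ ∣ Δx * + ℓ + + k * Δy
    kℓ∣sum = subst₂ _∣_ (trans (pos-* ℓ k) (*-comm (+ ℓ) (+ k))) (split x y x' y' (+ ℓ) (+ k)) ℓk∣difference
    ℓ∣kΔy : + ℓ ∣ + k * Δy
    ℓ∣kΔy = ∣m+n∣m⇒∣n (∣-trans (∣n⇒∣m*n (+ k) ∣-refl) kℓ∣sum) (∣n⇒∣m*n Δx ∣-refl)
    ℓ∣Δy : + ℓ ∣ Δy
    ℓ∣Δy = ∣ᵤ⇒∣ (coprime-divisor (+ ℓ) (+ k) Δy ℓ⊥k (∣⇒∣ᵤ ℓ∣kΔy))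
    kℓ∣Δxℓ : + k * + ℓ ∣ Δx * + ℓ
    kℓ∣Δxℓ = ∣m+n∣n⇒∣m kℓ∣sum (*-monoʳ-∣ (+ k) ℓ∣Δy)

  -- With uℓ + vk = 1, take x₀ + a ≡ ru (mod k) and y₀ + b ≡ rv (mod ℓ).
  crt-surjective : ∀ {ℓ k} .{{_ : NonZero ℓ}} .{{_ : NonZero k}} → Coprime ℓ k → ∀ x₀ y₀ r →
    ∃₂ λ a b → a ℕ.< k × b ℕ.< ℓ × (x₀ + + a) * + ℓ + (y₀ + + b) * + k ≡ r mod ℓ ℕ.* k
  crt-surjective {ℓ} {k} ℓ⊥k x₀ y₀ r =
    let u , v , uℓ+vk≡1 = bézout ℓ⊥k
        a , a<k , x₀+a≡ru = ∃-offset-≡-mod x₀ (r * u) k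
        b , b<ℓ , y₀+b≡rv = ∃-offset-≡-mod y₀ (r * v) ℓ
    in a , b , a<k , b<ℓ ,
       ≡-mod-trans
         (≡-mod-+ (≡-mod-*ʳ ℓ x₀+a≡ru)
                  (subst ((y₀ + + b) * + k ≡ r * v * + k mod_) (ℕ.*-comm k ℓ) (≡-mod-*ʳ k y₀+b≡rv)))
         (≡-mod-reflexive (begin
           r * u * + ℓ + r * v * + k  ≡⟨ factor r u v (+ ℓ) (+ k) ⟩
           r * (u * + ℓ + v * + k)    ≡⟨ cong (r *_) uℓ+vk≡1 ⟩
           r * + 1                    ≡⟨ *-identityʳ r ⟩
           r                          ∎))
    where
    factor : ∀ r u v ℓ k → r * u * ℓ + r * v * k ≡ r * (u * ℓ + v * k)
    factor = solve-∀

open Congruence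

-- B₂-sequences

addMod-comm : ∀ n .{{_ : NonZero n}} (x y : Fin n) → addMod n x y ≡ addMod n y x
addMod-comm n x y = cong (ℕ._% n) (ℕ.+-comm (toℕ x) (toℕ y))

B₂-sum-injective : ∀ {n} .{{_ : NonZero n}} {m} {D : Fin m → Fin n} → IsB₂ n m D → ∀ a b c d →
  addMod n (D a) (D b) ≡ addMod n (D c) (D d) → (a ≡ c × b ≡ d) ⊎ (a ≡ d × b ≡ c)
B₂-sum-injective {n} {D = D} (_ , b₂) a b c d eq with Fin.≤-total a b | Fin.≤-total c d
... | inj₁ a≤b | inj₁ c≤d = inj₁ (b₂ a b c d a≤b c≤d eq)
... | inj₁ a≤b | inj₂ d≤c = inj₂ (b₂ a b d c a≤b d≤c (trans eq (addMod-comm n (D c) (D d))))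
... | inj₂ b≤a | inj₁ c≤d = inj₂ (swap (b₂ b a c d b≤a c≤d (trans (addMod-comm n (D b) (D a)) eq)))
... | inj₂ b≤a | inj₂ d≤c =
  inj₁ (swap (b₂ b a d c b≤a d≤c (trans (addMod-comm n (D b) (D a)) (trans eq (addMod-comm n (D c) (D d))))))

-- The array

module Array (n : ℕ) .{{_ : NonZero n}} (ℓ k : ℕ) .{{_ : NonZero ℓ}} .{{_ : NonZero k}}
             (n≡ℓk : n ≡ ℓ ℕ.* k) where
  open import Data.Integer using (ℤ; +_; _+_; _*_; _%ℕ_)
  open import Data.Integer.Properties using (pos-*)
  open import Data.Integer.Tactic.RingSolver using (solve-∀)

  linear : ℤ → ℤ → ℤ
  linear i j = i * + ℓ + j * + k

  -- Dot n m D ℓ k i j is definitionally ∃[ t ] toℕ (D t) ≡ residue i j.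
  residue : ℤ → ℤ → ℕ
  residue i j = linear i j %ℕ n

  residueᵖ : Point → ℕ
  residueᵖ (i , j) = residue i j

  +ℓ*+k≡+n : + ℓ * + k ≡ + n
  +ℓ*+k≡+n = trans (sym (pos-* ℓ k)) (cong +_ (sym n≡ℓk))

  residue-+ℓk : ∀ i j i' j' → linear i' j' ≡ linear i j + + ℓ * + k → residue i' j' ≡ residue i j
  residue-+ℓk i j i' j' eq =
    trans (cong (_%ℕ n) (trans eq (cong (_+_ (linear i j)) +ℓ*+k≡+n))) ([i+d]%ℕd≡i%ℕd (linear i j) n)

  residue-i+k : ∀ i j → residue (i + + k) j ≡ residue i j
  residue-i+k i j = residue-+ℓk i j (i + + k) j (shift i j (+ ℓ) (+ k))
    where
    shift : ∀ i j ℓ k → (i + k) * ℓ + j * k ≡ i * ℓ + j * k + ℓ * k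
    shift = solve-∀

  residue-j+ℓ : ∀ i j → residue i (j + + ℓ) ≡ residue i j
  residue-j+ℓ i j = residue-+ℓk i j i (j + + ℓ) (shift i j (+ ℓ) (+ k))
    where
    shift : ∀ i j ℓ k → i * ℓ + (j + ℓ) * k ≡ i * ℓ + j * k + ℓ * k
    shift = solve-∀

  residue≡⇒≡-mod : Coprime ℓ k → ∀ {i j i' j'} → residue i j ≡ residue i' j' → i ≡ i' mod k × j ≡ j' mod ℓ
  residue≡⇒≡-mod ℓ⊥k {i} {j} {i'} {j'} eq =
    crt-injective ℓ⊥k (subst (linear i j ≡ linear i' j' mod_) n≡ℓk (%ℕ≡⇒≡-mod n eq))

  residue-block-injective : Coprime ℓ k → ∀ i₀ j₀ {a a' b b'} →
    a ℕ.< k → a' ℕ.< k → b ℕ.< ℓ → b' ℕ.< ℓ →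
    residue (i₀ + + a) (j₀ + + b) ≡ residue (i₀ + + a') (j₀ + + b') → a ≡ a' × b ≡ b'
  residue-block-injective ℓ⊥k i₀ j₀ a<k a'<k b<ℓ b'<ℓ eq =
    let i≡i' , j≡j' = residue≡⇒≡-mod ℓ⊥k eq
    in ≡-mod⇒≡ a<k a'<k (≡-mod-+-cancelˡ i₀ i≡i') , ≡-mod⇒≡ b<ℓ b'<ℓ (≡-mod-+-cancelˡ j₀ j≡j')

  residue-block-surjective : Coprime ℓ k → ∀ i₀ j₀ {r} → r ℕ.< n →
    ∃₂ λ a b → a ℕ.< k × b ℕ.< ℓ × residue (i₀ + + a) (j₀ + + b) ≡ r
  residue-block-surjective ℓ⊥k i₀ j₀ {r} r<n =
    let a , b , a<k , b<ℓ , ≡r = crt-surjective ℓ⊥k i₀ j₀ (+ r)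
    in a , b , a<k , b<ℓ ,
       trans (≡-mod⇒%ℕ≡ n (subst (linear (i₀ + + a) (j₀ + + b) ≡ + r mod_) (sym n≡ℓk) ≡r)) (ℕ.m<n⇒m%n≡m r<n)

  residue-sub-array-injective : Coprime ℓ k → ∀ {i₀ j₀ p p'} → InSub ℓ k i₀ j₀ p → InSub ℓ k i₀ j₀ p' →
    residueᵖ p ≡ residueᵖ p' → p ≡ p'
  residue-sub-array-injective ℓ⊥k
    ((i₀≤i , i<i₀+k) , (j₀≤j , j<j₀+ℓ)) ((i₀≤i' , i'<i₀+k) , (j₀≤j' , j'<j₀+ℓ)) eq =
    let i≡i' , j≡j' = residue≡⇒≡-mod ℓ⊥k eq
    in cong₂ _,_ (window-≡-mod⇒≡ i₀≤i i<i₀+k i₀≤i' i'<i₀+k i≡i')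
                 (window-≡-mod⇒≡ j₀≤j j<j₀+ℓ j₀≤j' j'<j₀+ℓ j≡j')

  addMod-residues : ∀ {u v : Fin n} x y → toℕ u ≡ x %ℕ n → toℕ v ≡ y %ℕ n → addMod n u v ≡ (x + y) %ℕ n
  addMod-residues x y u≡x v≡y = trans (cong₂ (λ a b → (a ℕ.+ b) ℕ.% n) u≡x v≡y) (sym (%ℕ-distrib-+ x y n))

  addMod-parallelogram : ∀ {u v u' v' : Fin n} {x y x' y' : Point} →
    toℕ u ≡ residueᵖ x → toℕ v ≡ residueᵖ y → toℕ u' ≡ residueᵖ x' → toℕ v' ≡ residueᵖ y' →
    x -ᵖ y ≡ x' -ᵖ y' → addMod n u v' ≡ addMod n u' v
  addMod-parallelogram {u} {v} {u'} {v'} {xi , xj} {yi , yj} {xi' , xj'} {yi' , yj'}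
                       u≡x v≡y u'≡x' v'≡y' x-y≡x'-y' = begin
    addMod n u v'                         ≡⟨ addMod-residues (linear xi xj) (linear yi' yj') u≡x v'≡y' ⟩
    (linear xi xj + linear yi' yj') %ℕ n  ≡⟨ cong (_%ℕ n) parallelogram ⟩
    (linear xi' xj' + linear yi yj) %ℕ n  ≡⟨ addMod-residues (linear xi' xj') (linear yi yj) u'≡x' v≡y ⟨
    addMod n u' v                         ∎
    where
    regroup : ∀ xi xj yi yj ℓ k → (xi * ℓ + xj * k) + (yi * ℓ + yj * k) ≡ (xi + yi) * ℓ + (xj + yj) * k
    regroup = solve-∀
    parallelogram : linear xi xj + linear yi' yj' ≡ linear xi' xj' + linear yi yj
    parallelogram = begin
      linear xi xj + linear yi' yj'        ≡⟨ regroup xi xj yi' yj' (+ ℓ) (+ k) ⟩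
      (xi + yi') * + ℓ + (xj + yj') * + k  ≡⟨ cong₂ (λ a b → a * + ℓ + b * + k)
                                                    (-≡-⇒+≡+ xi yi xi' yi' (cong proj₁ x-y≡x'-y'))
                                                    (-≡-⇒+≡+ xj yj xj' yj' (cong proj₂ x-y≡x'-y')) ⟩
      (xi' + yi) * + ℓ + (xj' + yj) * + k  ≡⟨ regroup xi' xj' yi yj (+ ℓ) (+ k) ⟨
      linear xi' xj' + linear yi yj        ∎

  module _ {m} (D : Fin m → Fin n) where

    labelled-cong : ∀ {r r'} → r ≡ r' → ∃[ t ] toℕ (D t) ≡ r → ∃[ t ] toℕ (D t) ≡ r'
    labelled-cong r≡r' (t , Dt≡r) = t , trans Dt≡r r≡r'

    Dot-doublyPeriodic : DoublyPeriodic (Dot n m D ℓ k) k ℓ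
    Dot-doublyPeriodic i j =
      labelled-cong (sym (residue-i+k i j)) , labelled-cong (residue-i+k i j) ,
      labelled-cong (sym (residue-j+ℓ i j)) , labelled-cong (residue-j+ℓ i j)

    sub-array-label-injective : Coprime ℓ k → ∀ {i₀ j₀} p p' {t t'} →
      InSub ℓ k i₀ j₀ p → InSub ℓ k i₀ j₀ p' → t ≡ t' →
      toℕ (D t) ≡ residueᵖ p → toℕ (D t') ≡ residueᵖ p' → p ≡ p'
    sub-array-label-injective ℓ⊥k p p' p∈ p'∈ refl Dt≡p Dt≡p' =
      residue-sub-array-injective ℓ⊥k {p = p} {p'} p∈ p'∈ (trans (sym Dt≡p) Dt≡p')

    Dot-DDC : IsB₂ n m D → Coprime ℓ k → ∀ i₀ j₀ → IsDDC (DotsIn (Dot n m D ℓ k) ℓ k i₀ j₀)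
    Dot-DDC D-B₂ ℓ⊥k i₀ j₀ x y x' y'
            (x∈ , tx , Dtx) (y∈ , ty , Dty) (x'∈ , tx' , Dtx') (y'∈ , ty' , Dty') x≢y _ x-y≡x'-y' =
      [ (λ (tx≡tx' , ty'≡ty) → sub-array-label-injective ℓ⊥k x x' x∈ x'∈ tx≡tx' Dtx Dtx' ,
                               sub-array-label-injective ℓ⊥k y y' y∈ y'∈ (sym ty'≡ty) Dty Dty')
      , (λ (tx≡ty , _) → ⊥-elim (x≢y (sub-array-label-injective ℓ⊥k x y x∈ y∈ tx≡ty Dtx Dty)))
      ]′ (B₂-sum-injective D-B₂ tx ty' tx' ty
            (addMod-parallelogram {x = x} {y} {x'} {y'} Dtx Dty Dtx' Dty' x-y≡x'-y'))

    Dot-count : Injective _≡_ _≡_ D → Coprime ℓ k → ∀ i₀ j₀ →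
                dotCount (Dot n m D ℓ k) (Dot? n m D ℓ k) ℓ k i₀ j₀ ≡ m
    Dot-count D-injective ℓ⊥k i₀ j₀ =
      trans (dotCount≡∑∑ (Dot n m D ℓ k) (Dot? n m D ℓ k) ℓ k i₀ j₀)
            (∑∑-𝟙-∈-image (toℕ ∘ D) (D-injective ∘ toℕ-injective) cell cell-injective cell-hits)
      where
      cell : Fin k → Fin ℓ → ℕ
      cell x y = residue (i₀ + + toℕ x) (j₀ + + toℕ y)
      cell-injective : ∀ {x y x' y'} → cell x y ≡ cell x' y' → x ≡ x' × y ≡ y'
      cell-injective {x} {y} {x'} {y'} eq =
        let x≡x' , y≡y' = residue-block-injective ℓ⊥k i₀ j₀ (toℕ<n x) (toℕ<n x') (toℕ<n y) (toℕ<n y') eq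
        in toℕ-injective x≡x' , toℕ-injective y≡y'
      cell-hits : ∀ t → ∃₂ λ x y → cell x y ≡ toℕ (D t)
      cell-hits t =
        let a , b , a<k , b<ℓ , hit = residue-block-surjective ℓ⊥k i₀ j₀ (toℕ<n (D t))
        in fromℕ< a<k , fromℕ< b<ℓ ,
           subst₂ (λ a b → residue (i₀ + + a) (j₀ + + b) ≡ toℕ (D t))
                  (sym (toℕ-fromℕ< a<k)) (sym (toℕ-fromℕ< b<ℓ)) hit

-- ℕ's _*_ is brought into scope only now: the integer lemmas above use ℤ's unqualified.
open import Data.Nat using (_*_)

theorem15 : (n : ℕ) .{{_ : NonZero n}} (m : ℕ) (D : Fin m → Fin n) →
    IsB₂ n m D → (ℓ k : ℕ) → NonZero ℓ → NonZero k → n ≡ ℓ * k → Coprime ℓ k →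
    DoublyPeriodicDDC (Dot n m D ℓ k) k ℓ ℓ k
    × HasDensity (Dot n m D ℓ k) (Dot? n m D ℓ k) k ℓ m n
    × (∀ i₀ j₀ → dotCount (Dot n m D ℓ k) (Dot? n m D ℓ k) ℓ k i₀ j₀ ≡ m)
theorem15 n m D D-B₂ ℓ k ℓ≢0 k≢0 n≡ℓk ℓ⊥k =
  (Dot-doublyPeriodic D , Dot-DDC D D-B₂ ℓ⊥k) , density , count
  where
  open Array n ℓ k {{ℓ≢0}} {{k≢0}} n≡ℓk
  count : ∀ i₀ j₀ → dotCount (Dot n m D ℓ k) (Dot? n m D ℓ k) ℓ k i₀ j₀ ≡ m
  count = Dot-count D (proj₁ D-B₂) ℓ⊥k
  density : HasDensity (Dot n m D ℓ k) (Dot? n m D ℓ k) k ℓ m n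
  density i₀ j₀ = trans (cong (_* n) (count i₀ j₀)) (cong (m *_) (trans n≡ℓk (ℕ.*-comm ℓ k)))
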